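{- Let $H$ be a connected graph. Then $D(H)\leqslant D(K_1\circ H)\leqslant D(H)+1$.
   Context: $K_1$ is the single-vertex graph; $K_1\circ H$ is the corona, i.e. the graph obtained from $H$ by adding one new vertex adjacent to every vertex of $H$ (in general $G\circ H$ takes one copy of $G$ and $|V(G)|$ copies of $H$ and joins the $i$-th vertex of $G$ to every vertex of the $i$-th copy of $H$). The distinguishing number $D(G)$ is the least $r$ such that some vertex labeling $V(G)\to\{1,\dots,r\}$ is preserved by no non-identity automorphism of $G$. -}

module Defs where

open import Data.Nat using (ℕ; zero; suc; _+_; _≤_; _<_)
open import Data.Fin using (Fin; zero; suc)
open import Data.Bool using (Bool; true; false)
open import Data.Product using (Σ; ∃; _×_)
open import Data.Fin.Permutation using (Permutation′; _⟨$⟩ʳ_)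
open import Relation.Binary.PropositionalEquality using (_≡_)
open import Relation.Nullary using (¬_)

record Graph : Set where
  field
    n      : ℕ
    adj    : Fin n → Fin n → Bool
    sym    : ∀ u v → adj u v ≡ adj v u
    irrefl : ∀ u → adj u u ≡ false
open Graph public

data Reachable (G : Graph) : Fin (n G) → Fin (n G) → Set where
  here : ∀ {u} → Reachable G u u
  step : ∀ {u v w} → adj G u v ≡ true → Reachable G v w → Reachable G u w

Connected : Graph → Set
Connected G = (0 < n G) × (∀ u v → Reachable G u v)

IsAutomorphism : (G : Graph) → Permutation′ (n G) → Set
IsAutomorphism G σ = ∀ u v → adj G (σ ⟨$⟩ʳ u) (σ ⟨$⟩ʳ v) ≡ adj G u v

IsDistinguishing : (G : Graph) {r : ℕ} → (Fin (n G) → Fin r) → Set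
IsDistinguishing G ℓ =
  ∀ (σ : Permutation′ (n G)) → IsAutomorphism G σ →
  (∀ u → ℓ (σ ⟨$⟩ʳ u) ≡ ℓ u) → ∀ u → σ ⟨$⟩ʳ u ≡ u

HasDistinguishingLabeling : Graph → ℕ → Set
HasDistinguishingLabeling G r =
  Σ (Fin (n G) → Fin r) λ ℓ → IsDistinguishing G ℓ

IsDistinguishingNumber : Graph → ℕ → Set
IsDistinguishingNumber G d =
  HasDistinguishingLabeling G d × (∀ r → r < d → ¬ HasDistinguishingLabeling G r)

-- The corona K₁ ∘ H: vertex zero is the new vertex, suc i is vertex i of H;
-- the new vertex is adjacent to every vertex of H.
coronaAdj : (H : Graph) → Fin (suc (n H)) → Fin (suc (n H)) → Bool
coronaAdj H zero    zero    = false
coronaAdj H zero    (suc _) = true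
coronaAdj H (suc _) zero    = true
coronaAdj H (suc i) (suc j) = adj H i j

coronaSym : (H : Graph) → ∀ u v → coronaAdj H u v ≡ coronaAdj H v u
coronaSym H zero    zero    = Relation.Binary.PropositionalEquality.refl
coronaSym H zero    (suc _) = Relation.Binary.PropositionalEquality.refl
coronaSym H (suc _) zero    = Relation.Binary.PropositionalEquality.refl
coronaSym H (suc i) (suc j) = sym H i j

coronaIrrefl : (H : Graph) → ∀ u → coronaAdj H u u ≡ false
coronaIrrefl H zero    = Relation.Binary.PropositionalEquality.refl
coronaIrrefl H (suc i) = irrefl H i

K₁∘ : Graph → Graph
K₁∘ H = record
  { n = suc (n H) ; adj = coronaAdj H ; sym = coronaSym H ; irrefl = coronaIrrefl H }

module Submission where

open import Defs
open import Data.Nat using (ℕ; suc; _≤_; _+_)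
open import Data.Nat.Properties using (≮⇒≥; +-comm)
open import Data.Fin using (Fin; zero; suc; fromℕ; inject₁)
open import Data.Fin.Properties using (suc-injective; fromℕ≢inject₁; inject₁-injective)
open import Data.Fin.Permutation using (Permutation′; _⟨$⟩ʳ_; lift₀; remove; lift₀-remove)
open import Data.Product using (_×_; _,_)
open import Data.Empty using (⊥-elim)
open import Relation.Binary.PropositionalEquality
  using (_≡_; refl; trans; cong; cong₂; subst) renaming (sym to ≡-sym)

-- A distinguishing labeling of K₁ ∘ H restricts to one of H, because every automorphism
-- of H extends to K₁ ∘ H by fixing the apex. Conversely, a distinguishing labeling of H
-- extended by a fresh label on the apex distinguishes K₁ ∘ H: any automorphism preserving
-- it must fix the apex, hence restricts to an automorphism of H preserving the labels.

distinguishingNumber-minimal : ∀ G {d r} → IsDistinguishingNumber G d →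
  HasDistinguishingLabeling G r → d ≤ r
distinguishingNumber-minimal G (_ , minimal) labeling =
  ≮⇒≥ λ r<d → minimal _ r<d labeling

lift₀-isAutomorphism : ∀ H σ → IsAutomorphism H σ → IsAutomorphism (K₁∘ H) (lift₀ σ)
lift₀-isAutomorphism H σ aut zero    zero    = refl
lift₀-isAutomorphism H σ aut zero    (suc v) = refl
lift₀-isAutomorphism H σ aut (suc u) zero    = refl
lift₀-isAutomorphism H σ aut (suc u) (suc v) = aut u v

remove-isAutomorphism : ∀ H τ → τ ⟨$⟩ʳ zero ≡ zero →
  IsAutomorphism (K₁∘ H) τ → IsAutomorphism H (remove zero τ)
remove-isAutomorphism H τ τ0≡0 aut u v =
  trans (cong₂ (coronaAdj H) (lift₀-remove τ τ0≡0 (suc u)) (lift₀-remove τ τ0≡0 (suc v)))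
        (aut (suc u) (suc v))

corona-distinguishable⇒distinguishable : ∀ H r →
  HasDistinguishingLabeling (K₁∘ H) r → HasDistinguishingLabeling H r
corona-distinguishable⇒distinguishable H r (L , distinguishing) =
  (λ i → L (suc i)) ,
  λ σ aut preserves u → suc-injective
    (distinguishing (lift₀ σ) (lift₀-isAutomorphism H σ aut) (lift₀-preserves σ preserves) (suc u))
  where
  lift₀-preserves : ∀ σ → (∀ u → L (suc (σ ⟨$⟩ʳ u)) ≡ L (suc u)) →
    ∀ u → L (lift₀ σ ⟨$⟩ʳ u) ≡ L u
  lift₀-preserves σ preserves zero    = refl
  lift₀-preserves σ preserves (suc u) = preserves u

distinguishable⇒corona-distinguishable : ∀ H r →
  HasDistinguishingLabeling H r → HasDistinguishingLabeling (K₁∘ H) (suc r)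
distinguishable⇒corona-distinguishable H r (ℓ , distinguishing) = L , L-distinguishing
  where
  L : Fin (suc (n H)) → Fin (suc r)
  L zero    = fromℕ r
  L (suc i) = inject₁ (ℓ i)

  L-distinguishing : IsDistinguishing (K₁∘ H) L
  L-distinguishing τ aut preserves = fixes
    where
    τ-fixes-apex : τ ⟨$⟩ʳ zero ≡ zero
    τ-fixes-apex with τ ⟨$⟩ʳ zero | preserves zero
    ... | zero  | _       = refl
    ... | suc _ | L-equal = ⊥-elim (fromℕ≢inject₁ (≡-sym L-equal))

    σ : Permutation′ (n H)
    σ = remove zero τ

    σ-lifts : ∀ i → suc (σ ⟨$⟩ʳ i) ≡ τ ⟨$⟩ʳ suc i
    σ-lifts i = lift₀-remove τ τ-fixes-apex (suc i)

    σ-preserves : ∀ u → ℓ (σ ⟨$⟩ʳ u) ≡ ℓ u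
    σ-preserves u = inject₁-injective (trans (cong L (σ-lifts u)) (preserves (suc u)))

    fixes : ∀ u → τ ⟨$⟩ʳ u ≡ u
    fixes zero    = τ-fixes-apex
    fixes (suc u) = trans (≡-sym (σ-lifts u))
      (cong suc (distinguishing σ (remove-isAutomorphism H τ τ-fixes-apex aut) σ-preserves u))

mainTheorem11 : (H : Graph) → Connected H → (d d′ : ℕ) →
    IsDistinguishingNumber H d → IsDistinguishingNumber (K₁∘ H) d′ →
    (d ≤ d′) × (d′ ≤ d + 1)
mainTheorem11 H _ d d′ D[H]≡d@(labeling , _) D[K₁∘H]≡d′@(labeling∘ , _) =
  distinguishingNumber-minimal H D[H]≡d (corona-distinguishable⇒distinguishable H d′ labeling∘) ,
  subst (d′ ≤_) (+-comm 1 d)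
    (distinguishingNumber-minimal (K₁∘ H) D[K₁∘H]≡d′ (distinguishable⇒corona-distinguishable H d labeling))
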